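{- Let $\Gamma$ be a bipartite graph of size $e$ and let $d$ be a positive divisor of $e$. If $\Gamma$ admits a $d$-graceful $\alpha$-labeling, then for every integer $n\ge 1$ there exists a cyclic $\Gamma$-decomposition of the complete multipartite graph $K_{(\frac{e}{d}+1)\times 2dn}$.
   Context: For a graph $\Gamma$ of size $e$ and a divisor $d$ of $e$ with $e=d\cdot m$, a $d$-graceful labeling of $\Gamma$ is an injective function $f:V(\Gamma)\to\{0,1,\ldots,d(m+1)-1\}$ such that $\{|f(x)-f(y)| : [x,y]\in E(\Gamma)\}=\{1,2,\ldots,d(m+1)-1\}\setminus\{m+1,2(m+1),\ldots,(d-1)(m+1)\}$. If $\Gamma$ is bipartite with parts $X,Y$, a $d$-graceful $\alpha$-labeling is a $d$-graceful labeling $f$ such that $\max f(X)<\min f(Y)$ for a suitable ordering of the two parts. $K_{a\times b}$ denotes the complete $a$-partite graph with $a$ parts each of size $b$. A $\Gamma$-decomposition of a graph $K$ is a set of subgraphs of $K$ each isomorphic to $\Gamma$ whose edge sets partition $E(K)$; it is cyclic if some bijection of $V(K)$ that is a single cycle of length $|V(K)|$ maps the set of blocks onto itself. -}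

module Defs where

open import Data.Nat using (ℕ; zero; suc; _+_; _*_; _≤_; _<_; ∣_-_∣)
open import Data.Nat.Divisibility using (_∣_)
open import Data.Fin using (Fin)
open import Data.Bool using (Bool; true; false)
open import Data.Product using (Σ; ∃; ∃-syntax; _×_; _,_; proj₁; proj₂)
open import Data.Sum using (_⊎_)
open import Data.List using (List; length)
open import Data.List.Relation.Unary.All using (All)
open import Data.List.Relation.Unary.Any using (Any)
open import Data.List.Relation.Unary.AllPairs using (AllPairs)
open import Relation.Nullary using (¬_)
open import Relation.Binary.PropositionalEquality using (_≡_; _≢_)
open import Function.Bundles using (_⇔_; _↔_; Inverse)
open import Function.Definitions using (Injective)

SameEdge : {A : Set} → A × A → A × A → Set
SameEdge (x , y) (x' , y') = (x ≡ x' × y ≡ y') ⊎ (x ≡ y' × y ≡ x')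

record Graph : Set where
  field
    nV    : ℕ
    E     : List (Fin nV × Fin nV)
    noLoop : All (λ p → proj₁ p ≢ proj₂ p) E
    noDup  : AllPairs (λ p q → ¬ SameEdge p q) E
open Graph public

size : Graph → ℕ
size Γ = length (E Γ)

-- proper 2-colouring (bipartition X = colour false, Y = colour true)
Proper2Col : (Γ : Graph) → (Fin (nV Γ) → Bool) → Set
Proper2Col Γ c = All (λ p → c (proj₁ p) ≢ c (proj₂ p)) (E Γ)

IsBipartite : Graph → Set
IsBipartite Γ = ∃[ c ] Proper2Col Γ c

InDiffSet : (Γ : Graph) → (Fin (nV Γ) → ℕ) → ℕ → Set
InDiffSet Γ f k = Any (λ p → ∣ f (proj₁ p) - f (proj₂ p) ∣ ≡ k) (E Γ)

InTarget : ℕ → ℕ → ℕ → Set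
InTarget d m k = (1 ≤ k × suc k ≤ d * suc m)
               × ¬ (Σ ℕ λ j → 1 ≤ j × suc j ≤ d × k ≡ j * suc m)

-- d-graceful labeling of Γ, where size Γ = d * m
IsDGraceful : (Γ : Graph) → (d m : ℕ) → (Fin (nV Γ) → ℕ) → Set
IsDGraceful Γ d m f =
    Injective _≡_ _≡_ f
  × (∀ x → suc (f x) ≤ d * suc m)
  × (∀ k → InDiffSet Γ f k ⇔ InTarget d m k)

IsDGracefulAlpha : (Γ : Graph) → (d m : ℕ) → (Fin (nV Γ) → ℕ) → Set
IsDGracefulAlpha Γ d m f =
    IsDGraceful Γ d m f
  × (∃[ c ] (Proper2Col Γ c
       × (∀ x y → c x ≡ false → c y ≡ true → f x < f y)))

HasDGracefulAlpha : Graph → ℕ → ℕ → Set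
HasDGracefulAlpha Γ d m = ∃[ f ] IsDGracefulAlpha Γ d m f

-- Complete multipartite graph K_{a×b}: vertices Fin a × Fin b (part, index),
-- adjacent iff in different parts.
KV : ℕ → ℕ → Set
KV a b = Fin a × Fin b

KAdj : {a b : ℕ} → KV a b → KV a b → Set
KAdj u w = proj₁ u ≢ proj₁ w

record Copy (Γ : Graph) (a b : ℕ) : Set where
  field
    φ     : Fin (nV Γ) → KV a b
    φ-inj : Injective _≡_ _≡_ φ
    φ-edge : All (λ p → KAdj (φ (proj₁ p)) (φ (proj₂ p))) (E Γ)
open Copy public

Covers : {Γ : Graph} {a b : ℕ} → Copy Γ a b → KV a b → KV a b → Set
Covers {Γ} B u w = Any (λ p → SameEdge (φ B (proj₁ p) , φ B (proj₂ p)) (u , w)) (E Γ)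

record Decomposition (Γ : Graph) (a b : ℕ) : Set where
  field
    t      : ℕ
    block  : Fin t → Copy Γ a b
    partition : ∀ u w → KAdj u w →
      Σ (Fin t) λ k → Covers (block k) u w × (∀ k' → Covers (block k') u w → k' ≡ k)
open Decomposition public

iter : {A : Set} → (A → A) → ℕ → A → A
iter σ zero u = u
iter σ (suc k) u = σ (iter σ k u)

-- a bijection of a finite set that is a single cycle of full length:
-- every vertex lies in the σ-orbit of every other one.
IsFullCycle : {A : Set} → A ↔ A → Set
IsFullCycle {A} σ = ∀ (u w : A) → ∃[ k ] iter (Inverse.to σ) k u ≡ w

MapsOnto : {Γ : Graph} {a b : ℕ} → KV a b ↔ KV a b → Copy Γ a b → Copy Γ a b → Set
MapsOnto {Γ} σ B B' =
    (∀ u w → Covers B u w ⇔ Covers B' (Inverse.to σ u) (Inverse.to σ w))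
  × (∀ x → ∃[ x' ] φ B' x' ≡ Inverse.to σ (φ B x))
  × (∀ x' → ∃[ x ] φ B' x' ≡ Inverse.to σ (φ B x))

IsCyclic : {Γ : Graph} {a b : ℕ} → Decomposition Γ a b → Set
IsCyclic D = ∃[ σ ] (IsFullCycle σ
  × (∀ k → ∃[ k' ] MapsOnto σ (block D k) (block D k'))
  × (∀ k' → ∃[ k ] MapsOnto σ (block D k) (block D k')))

module Submission where

-- Identify the vertices of K_{M×N} (M = m + 1 parts, N = 2dn) with ℤ_v,
-- v = N·M = 2H, H = n·d·M, so that label z lies in part z mod M; the rotation
-- z ↦ z + 1 is then a single v-cycle.  From the α-labeling f we build n base
-- blocks: block i keeps f on the colour class X and adds i·d·M on Y.  Their
-- edge differences are the graceful differences shifted by multiples of d·M,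
-- so they run exactly once through the numbers in (0, H) not divisible by M
-- (a short difference family; that the graceful differences are distinct is a
-- counting argument).  Every edge of K_{M×N} has exactly one difference ±δ
-- with δ in that range, so the v translates of the base blocks partition the
-- edges, and the rotation permutes the translates of each base block.

open import Defs
open import Data.Nat
open import Data.Nat.Properties
open import Data.Nat.DivMod
open import Data.Nat.Tactic.RingSolver using (solve-∀)
open import Data.Nat.Divisibility using (_∣_; divides; _∣0; divides-refl; ∣m+n∣m⇒∣n; ∣m∣n⇒∣m+n; ∣n⇒∣m*n; n∣m*n; m%n≡0⇒n∣m; n∣m⇒m%n≡0)
open import Data.Fin using (Fin; zero; suc; toℕ; fromℕ<; punchOut; remQuot; combine)
open import Data.Fin.Properties
  using (any?; injective⇒≤; punchOut-injective; toℕ-fromℕ<; fromℕ<-cong; fromℕ<-toℕ; toℕ-injective;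
         toℕ<n; toℕ-combine; remQuot-combine; combine-remQuot)
  renaming (_≟_ to _≟ᶠ_)
open import Data.Product
open import Data.Bool using (Bool; true; false) renaming (_≟_ to _≟ᵇ_)
open import Data.Empty using (⊥-elim)
open import Data.Sum using (_⊎_; inj₁; inj₂)
open import Data.List using (List; []; _∷_; lookup)
open import Data.List.Relation.Unary.All as All using (All; []; _∷_)
open import Data.List.Relation.Unary.Any as Any using (Any)
open import Data.List.Relation.Unary.Any.Properties using (lookup-index)
open import Data.List.Membership.Propositional using (lose)
open import Data.List.Membership.Propositional.Properties using (∈-lookup)
open import Relation.Nullary using (¬_; yes; no; contradiction)
open import Relation.Binary.PropositionalEquality
open import Function.Base using (_∘_)
open import Function.Bundles using (_⇔_; _↔_; Inverse; Equivalence; mk⇔; mk↔ₛ′)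
open import Function.Definitions using (Injective)

module Modulo (q : ℕ) .{{_ : NonZero q}} where

  infix 4 _≈_

  _≈_ : ℕ → ℕ → Set
  a ≈ b = a % q ≡ b % q

  ≈-+ : ∀ {a a' b b'} → a ≈ a' → b ≈ b' → a + b ≈ a' + b'
  ≈-+ {a} {a'} {b} {b'} a≈a' b≈b' = begin
    (a + b) % q            ≡⟨ %-distribˡ-+ a b q ⟩
    (a % q + b % q) % q    ≡⟨ cong₂ (λ x y → (x + y) % q) a≈a' b≈b' ⟩
    (a' % q + b' % q) % q  ≡⟨ %-distribˡ-+ a' b' q ⟨
    (a' + b') % q          ∎
    where open ≡-Reasoning

  %-≈ : ∀ a → a % q ≈ a
  %-≈ a = m%n%n≡m%n a q

  -- (0 % q does not compute for an abstract q)
  0%q : 0 % q ≡ 0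
  0%q = m<n⇒m%n≡m (>-nonZero⁻¹ q)

  ≈⇒≡ : ∀ {a b} → a < q → b < q → a ≈ b → a ≡ b
  ≈⇒≡ a<q b<q a≈b = trans (sym (m<n⇒m%n≡m a<q)) (trans a≈b (m<n⇒m%n≡m b<q))

  complement : ∀ a → q ∣ a + (q ∸ a % q)
  complement a = m%n≡0⇒n∣m _ q (begin
    (a + (q ∸ a % q)) % q                         ≡⟨ cong (λ x → (x + (q ∸ a % q)) % q) (m≡m%n+[m/n]*n a q) ⟩
    (a % q + a / q * q + (q ∸ a % q)) % q         ≡⟨ cong (_% q) (+-comm (a % q + a / q * q) _) ⟩
    ((q ∸ a % q) + (a % q + a / q * q)) % q       ≡⟨ cong (_% q) (+-assoc (q ∸ a % q) (a % q) _) ⟨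
    ((q ∸ a % q) + a % q + a / q * q) % q         ≡⟨ cong (λ x → (x + a / q * q) % q) (m∸n+n≡m (m%n≤n a q)) ⟩
    (q + a / q * q) % q                           ≡⟨ [m+kn]%n≡m%n q (a / q) q ⟩
    q % q                                         ≡⟨ n%n≡0 q ⟩
    0                                             ∎)
    where open ≡-Reasoning

  ≈-cancelˡ : ∀ s {a b} → s + a ≈ s + b → a ≈ b
  ≈-cancelˡ s {a} {b} s+a≈s+b = begin
    a % q                   ≡⟨ %-remove-+ˡ a (complement s) ⟨
    (s + s⁻ + a) % q        ≡⟨ cong (_% q) (reassoc a) ⟩
    (s⁻ + (s + a)) % q      ≡⟨ ≈-+ {s⁻} refl s+a≈s+b ⟩
    (s⁻ + (s + b)) % q      ≡⟨ cong (_% q) (reassoc b) ⟨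
    (s + s⁻ + b) % q        ≡⟨ %-remove-+ˡ b (complement s) ⟩
    b % q                   ∎
    where
    open ≡-Reasoning
    s⁻ : ℕ
    s⁻ = q ∸ s % q
    reassoc : ∀ x → s + s⁻ + x ≡ s⁻ + (s + x)
    reassoc x = trans (cong (_+ x) (+-comm s s⁻)) (+-assoc s⁻ s x)

  ≈-shift⇒∣ : ∀ a {x} → a ≈ a + x → q ∣ x
  ≈-shift⇒∣ a {x} a≈a+x = m%n≡0⇒n∣m x q (trans (sym (≈-cancelˡ a (trans (cong (_% q) (+-identityʳ a)) a≈a+x))) 0%q)

  diffMod : ℕ → ℕ → ℕ
  diffMod a b = (b + (q ∸ a % q)) % q

  diffMod<q : ∀ a b → diffMod a b < q
  diffMod<q a b = m%n<n _ q

  +diffMod : ∀ a b → a + diffMod a b ≈ b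
  +diffMod a b = begin
    (a + diffMod a b) % q   ≡⟨ ≈-+ {a} refl (%-≈ (b + a⁻)) ⟩
    (a + (b + a⁻)) % q      ≡⟨ cong (_% q) (trans (cong (a +_) (+-comm b a⁻)) (sym (+-assoc a a⁻ b))) ⟩
    (a + a⁻ + b) % q        ≡⟨ %-remove-+ˡ b (complement a) ⟩
    b % q                   ∎
    where
    open ≡-Reasoning
    a⁻ : ℕ
    a⁻ = q ∸ a % q

  diffMod-unique : ∀ {a b x} → a + x ≈ b → x < q → x ≡ diffMod a b
  diffMod-unique {a} {b} {x} a+x≈b x<q =
    ≈⇒≡ x<q (diffMod<q a b) (≈-cancelˡ a (trans a+x≈b (sym (+diffMod a b))))

  diffMod-flip : ∀ a b → 0 < diffMod a b → diffMod b a ≡ q ∸ diffMod a b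
  diffMod-flip a b 0<x = sym (diffMod-unique b+[q∸x]≈a (∸-monoʳ-< 0<x (<⇒≤ (diffMod<q a b))))
    where
    open ≡-Reasoning
    x : ℕ
    x = diffMod a b
    b+[q∸x]≈a : b + (q ∸ x) ≈ a
    b+[q∸x]≈a = begin
      (b + (q ∸ x)) % q          ≡⟨ ≈-+ {b} (sym (+diffMod a b)) refl ⟩
      (a + x + (q ∸ x)) % q      ≡⟨ cong (_% q) (trans (+-assoc a x _) (cong (a +_) (m+[n∸m]≡n (<⇒≤ (diffMod<q a b))))) ⟩
      (a + q) % q                ≡⟨ [m+n]%n≡m%n a q ⟩
      a % q                      ∎

digits : ∀ {K r} .{{_ : NonZero K}} q → r < K → (r + q * K) % K ≡ r × (r + q * K) / K ≡ q
digits {K} {r} q r<K =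
  trans ([m+kn]%n≡m%n r q K) (m<n⇒m%n≡m r<K) ,
  trans (+-distrib-/-∣ʳ r (divides-refl q)) (cong₂ _+_ (m<n⇒m/n≡0 r<K) (m*n/n≡m q K))

digits-injective : ∀ {K r r' q q'} .{{_ : NonZero K}} → r < K → r' < K →
                   r + q * K ≡ r' + q' * K → r ≡ r' × q ≡ q'
digits-injective {K} {r} {r'} {q} {q'} r<K r'<K eq =
  trans (sym (proj₁ (digits q r<K))) (trans (cong (_% K) eq) (proj₁ (digits q' r'<K))) ,
  trans (sym (proj₂ (digits q r<K))) (trans (cong (_/ K) eq) (proj₂ (digits q' r'<K)))

digits-< : ∀ {r K q Q} → r < K → q < Q → r + q * K < Q * K
digits-< {r} {K} {q} r<K q<Q = ≤-trans (+-monoˡ-≤ (q * K) r<K) (*-monoˡ-≤ K q<Q)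

injective⇒surjective : ∀ {n} (g : Fin n → Fin n) → Injective _≡_ _≡_ g → ∀ k → ∃[ y ] g y ≡ k
injective⇒surjective {suc n} g g-inj k with any? (λ y → g y ≟ᶠ k)
... | yes hit = hit
... | no miss = contradiction (injective⇒≤ squeezed-injective) (n≮n n)
  where
  -- g avoids k, so it squeezes Fin (suc n) injectively into Fin n
  avoids : ∀ y → k ≢ g y
  avoids y k≡gy = miss (y , sym k≡gy)
  squeezed : Fin (suc n) → Fin n
  squeezed y = punchOut (avoids y)
  squeezed-injective : Injective _≡_ _≡_ squeezed
  squeezed-injective {x} {y} eq = g-inj (punchOut-injective (avoids x) (avoids y) eq)

-- A surjective endomap h of a finite set is injective: a section g of h is
-- injective, hence surjective, so h is determined on all of Fin n by h ∘ g = id.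
surjective⇒injective : ∀ {n} (h : Fin n → Fin n) → (∀ t → ∃[ j ] h j ≡ t) → Injective _≡_ _≡_ h
surjective⇒injective h onto {i} {j} hi≡hj = begin
  i       ≡⟨ proj₂ i-hit ⟨
  g a     ≡⟨ cong g a≡b ⟩
  g b     ≡⟨ proj₂ j-hit ⟩
  j       ∎
  where
  open ≡-Reasoning
  g : Fin _ → Fin _
  g = proj₁ ∘ onto
  h∘g≡id : ∀ t → h (g t) ≡ t
  h∘g≡id = proj₂ ∘ onto
  g-injective : Injective _≡_ _≡_ g
  g-injective {a} {b} ga≡gb = trans (sym (h∘g≡id a)) (trans (cong h ga≡gb) (h∘g≡id b))
  i-hit : ∃[ a ] g a ≡ i
  i-hit = injective⇒surjective g g-injective i
  j-hit : ∃[ b ] g b ≡ j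
  j-hit = injective⇒surjective g g-injective j
  a b : Fin _
  a = proj₁ i-hit
  b = proj₁ j-hit
  a≡b : a ≡ b
  a≡b = begin
    a          ≡⟨ h∘g≡id a ⟨
    h (g a)    ≡⟨ cong h (proj₂ i-hit) ⟩
    h i        ≡⟨ hi≡hj ⟩
    h j        ≡⟨ cong h (proj₂ j-hit) ⟨
    h (g b)    ≡⟨ h∘g≡id b ⟩
    b          ∎

onto-code⇒injective : ∀ {L} {A : Set} (f : Fin L → A) (code : A → ℕ) →
  (code< : ∀ j → code (f j) < L) → (∀ t → t < L → ∃[ j ] code (f j) ≡ t) →
  Injective _≡_ _≡_ f
onto-code⇒injective {L} f code code< onto {i} {j} fi≡fj =
  surjective⇒injective h h-onto (fromℕ<-cong _ _ (cong code fi≡fj) (code< i) (code< j))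
  where
  h : Fin L → Fin L
  h j = fromℕ< (code< j)
  h-onto : ∀ t → ∃[ j ] h j ≡ t
  h-onto t = let (j , eq) = onto (toℕ t) (toℕ<n t) in
    j , toℕ-injective (trans (toℕ-fromℕ< _) eq)

module _ {A : Set} {x y x' y' : A} where

  SameEdge-sym : SameEdge (x , y) (x' , y') → SameEdge (x' , y') (x , y)
  SameEdge-sym (inj₁ (refl , refl)) = inj₁ (refl , refl)
  SameEdge-sym (inj₂ (refl , refl)) = inj₂ (refl , refl)

  SameEdge-swap : SameEdge (x , y) (x' , y') → SameEdge (x , y) (y' , x')
  SameEdge-swap (inj₁ e) = inj₂ e
  SameEdge-swap (inj₂ e) = inj₁ e

  SameEdge-trans : ∀ {x'' y''} → SameEdge (x , y) (x' , y') → SameEdge (x' , y') (x'' , y'') →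
                   SameEdge (x , y) (x'' , y'')
  SameEdge-trans (inj₁ (refl , refl)) e = e
  SameEdge-trans (inj₂ (refl , refl)) (inj₁ (e₁ , e₂)) = inj₂ (e₂ , e₁)
  SameEdge-trans (inj₂ (refl , refl)) (inj₂ (e₁ , e₂)) = inj₁ (e₂ , e₁)

  SameEdge-map : ∀ {B : Set} (h : A → B) → SameEdge (x , y) (x' , y') → SameEdge (h x , h y) (h x' , h y')
  SameEdge-map h (inj₁ (refl , refl)) = inj₁ (refl , refl)
  SameEdge-map h (inj₂ (refl , refl)) = inj₂ (refl , refl)

  SameEdge-reflect : ∀ {B : Set} {h : A → B} → Injective _≡_ _≡_ h →
                     SameEdge (h x , h y) (h x' , h y') → SameEdge (x , y) (x' , y')
  SameEdge-reflect h-inj (inj₁ (e₁ , e₂)) = inj₁ (h-inj e₁ , h-inj e₂)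
  SameEdge-reflect h-inj (inj₂ (e₁ , e₂)) = inj₂ (h-inj e₁ , h-inj e₂)

record Orientation (Γ : Graph) : Set where
  field
    low high : Fin (size Γ) → Fin (nV Γ)
    oriented : ∀ j → SameEdge (lookup (E Γ) j) (low j , high j)

module _ {Γ : Graph} (O : Orientation Γ) {a b : ℕ} where
  open Orientation O

  orientedCopy : (φ : Fin (nV Γ) → KV a b) → Injective _≡_ _≡_ φ →
                 (∀ j → KAdj (φ (low j)) (φ (high j))) → Copy Γ a b
  orientedCopy φ φ-inj separates = record { φ = φ ; φ-inj = φ-inj ; φ-edge = all-edges (E Γ) edge-at }
    where
    Separated : Fin (nV Γ) × Fin (nV Γ) → Set
    Separated p = KAdj (φ (proj₁ p)) (φ (proj₂ p))
    edge-at : ∀ j → Separated (lookup (E Γ) j)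
    edge-at j with oriented j
    ... | inj₁ (e₁ , e₂) = subst₂ (λ x y → KAdj (φ x) (φ y)) (sym e₁) (sym e₂) (separates j)
    ... | inj₂ (e₁ , e₂) = subst₂ (λ x y → KAdj (φ y) (φ x)) (sym e₂) (sym e₁) (separates j ∘ sym)
    all-edges : (es : List (Fin (nV Γ) × Fin (nV Γ))) → (∀ j → Separated (lookup es j)) → All Separated es
    all-edges []       _        = []
    all-edges (e ∷ es) sep-at   = sep-at zero ∷ all-edges es (sep-at ∘ suc)

  CoversVia : Copy Γ a b → Fin (size Γ) → KV a b → KV a b → Set
  CoversVia B j u w = SameEdge (φ B (low j) , φ B (high j)) (u , w)

  covers⇔ : (B : Copy Γ a b) (u w : KV a b) → Covers B u w ⇔ (∃[ j ] CoversVia B j u w)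
  covers⇔ B u w = mk⇔ to from
    where
    image-oriented : ∀ j → SameEdge (φ B (proj₁ (lookup (E Γ) j)) , φ B (proj₂ (lookup (E Γ) j)))
                                    (φ B (low j) , φ B (high j))
    image-oriented j = SameEdge-map (φ B) (oriented j)
    to : Covers B u w → ∃[ j ] CoversVia B j u w
    to cov = Any.index cov , SameEdge-trans (SameEdge-sym (image-oriented (Any.index cov))) (lookup-index cov)
    from : ∃[ j ] CoversVia B j u w → Covers B u w
    from (j , via) = lose (∈-lookup j) (SameEdge-trans (image-oriented j) via)

Covers-sym : ∀ {Γ a b} (B : Copy Γ a b) {u w : KV a b} → Covers B u w → Covers B w u
Covers-sym B = Any.map SameEdge-swap

image-mapsOnto : ∀ {Γ a b} (σ : KV a b ↔ KV a b) (B B' : Copy Γ a b) →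
                 (∀ x → φ B' x ≡ Inverse.to σ (φ B x)) → MapsOnto σ B B'
image-mapsOnto {Γ} σ B B' φ'≡σ∘φ =
  (λ u w → mk⇔ (Any.map forth) (Any.map back)) , (λ x → x , φ'≡σ∘φ x) , (λ x → x , φ'≡σ∘φ x)
  where
  open Inverse σ using (to; from; strictlyInverseʳ)
  to-injective : Injective _≡_ _≡_ to
  to-injective {x} {y} eq = trans (sym (strictlyInverseʳ x)) (trans (cong from eq) (strictlyInverseʳ y))
  image : (p : Fin (nV Γ) × Fin (nV Γ)) →
          (φ B' (proj₁ p) , φ B' (proj₂ p)) ≡ (to (φ B (proj₁ p)) , to (φ B (proj₂ p)))
  image (x , y) = cong₂ _,_ (φ'≡σ∘φ x) (φ'≡σ∘φ y)
  forth : ∀ {u w p} → SameEdge (φ B (proj₁ p) , φ B (proj₂ p)) (u , w) →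
          SameEdge (φ B' (proj₁ p) , φ B' (proj₂ p)) (to u , to w)
  forth {u} {w} {p} e = subst (λ z → SameEdge z (to u , to w)) (sym (image p)) (SameEdge-map to e)
  back : ∀ {u w p} → SameEdge (φ B' (proj₁ p) , φ B' (proj₂ p)) (to u , to w) →
         SameEdge (φ B (proj₁ p) , φ B (proj₂ p)) (u , w)
  back {u} {w} {p} e = SameEdge-reflect to-injective (subst (λ z → SameEdge z (to u , to w)) (image p) e)

-- The complete multipartite graph K_{M×N} as the cyclic group ℤ_v, v = N·M:
-- the vertex labelled z lies in part z mod M, so two labels are adjacent iff
-- they differ mod M, and the rotation z ↦ z + 1 is a full-length cycle.
module CyclicModel (M N : ℕ) .{{_ : NonZero M}} .{{_ : NonZero N}} where

  v : ℕ
  v = N * M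

  instance
    v-nonZero : NonZero v
    v-nonZero = m*n≢0 N M

  open Modulo v public

  -- the vertex (r , q), i.e. the q-th vertex of part r, sits at position r + M q
  position : KV M N → Fin v
  position (r , q) = combine q r

  vertexAt : Fin v → KV M N
  vertexAt k = swap (remQuot M k)

  vertex : ℕ → KV M N
  vertex z = vertexAt (fromℕ< (m%n<n z v))

  label : KV M N → ℕ
  label u = toℕ (position u)

  label<v : ∀ u → label u < v
  label<v u = toℕ<n (position u)

  part-position : ∀ u → toℕ (position u) % M ≡ toℕ (proj₁ u)
  part-position (r , q) = begin
    toℕ (combine q r) % M     ≡⟨ cong (_% M) (trans (toℕ-combine q r) (trans (+-comm (M * toℕ q) (toℕ r)) (cong (toℕ r +_) (*-comm M (toℕ q))))) ⟩
    (toℕ r + toℕ q * M) % M   ≡⟨ proj₁ (digits (toℕ q) (toℕ<n r)) ⟩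
    toℕ r                     ∎
    where open ≡-Reasoning

  label-vertex : ∀ z → label (vertex z) ≡ z % v
  label-vertex z = trans (cong toℕ (combine-remQuot {N} M _)) (toℕ-fromℕ< _)

  vertex-label : ∀ u → vertex (label u) ≡ u
  vertex-label u =
    trans (cong vertexAt (trans (fromℕ<-cong _ _ (m<n⇒m%n≡m (label<v u)) _ (label<v u)) (fromℕ<-toℕ _ _)))
          (cong swap (remQuot-combine (proj₂ u) (proj₁ u)))

  vertex-cong : ∀ {a b} → a ≈ b → vertex a ≡ vertex b
  vertex-cong a≈b = cong vertexAt (fromℕ<-cong _ _ a≈b _ _)

  vertex-injective : ∀ {a b} → vertex a ≡ vertex b → a ≈ b
  vertex-injective {a} {b} eq = trans (sym (label-vertex a)) (trans (cong label eq) (label-vertex b))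

  part-vertex : ∀ z → toℕ (proj₁ (vertex z)) ≡ z % M
  part-vertex z = begin
    toℕ (proj₁ (vertex z))         ≡⟨ part-position (vertex z) ⟨
    label (vertex z) % M           ≡⟨ cong (_% M) (label-vertex z) ⟩
    z % v % M                      ≡⟨ m∣n⇒o%n%m≡o%m M v z (n∣m*n N) ⟩
    z % M                          ∎
    where open ≡-Reasoning

  separated⇒≢ : ∀ {a b} → KAdj (vertex a) (vertex b) → a % M ≢ b % M
  separated⇒≢ {a} {b} sep a≡b = sep (toℕ-injective (trans (part-vertex a) (trans a≡b (sym (part-vertex b)))))

  ≢⇒separated : ∀ {a b} → a % M ≢ b % M → KAdj (vertex a) (vertex b)
  ≢⇒separated {a} {b} a≢b same = a≢b (trans (sym (part-vertex a)) (trans (cong toℕ same) (part-vertex b)))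

  rotate unrotate : KV M N → KV M N
  rotate u = vertex (suc (label u))
  unrotate u = vertex (diffMod 1 (label u))

  rotate-vertex : ∀ z → rotate (vertex z) ≡ vertex (suc z)
  rotate-vertex z = vertex-cong (≈-+ {1} refl (trans (cong (_% v) (label-vertex z)) (%-≈ z)))

  rotation : KV M N ↔ KV M N
  rotation = mk↔ₛ′ rotate unrotate rotate∘unrotate unrotate∘rotate
    where
    rotate∘unrotate : ∀ u → rotate (unrotate u) ≡ u
    rotate∘unrotate u = begin
      rotate (vertex (diffMod 1 (label u)))   ≡⟨ rotate-vertex _ ⟩
      vertex (1 + diffMod 1 (label u))        ≡⟨ vertex-cong (+diffMod 1 (label u)) ⟩
      vertex (label u)                        ≡⟨ vertex-label u ⟩
      u                                       ∎
      where open ≡-Reasoning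
    unrotate∘rotate : ∀ u → unrotate (rotate u) ≡ u
    unrotate∘rotate u = begin
      vertex (diffMod 1 (label (vertex (suc (label u)))))  ≡⟨ cong vertex (diffMod-unique 1+a≈ (label<v u)) ⟨
      vertex (label u)                                     ≡⟨ vertex-label u ⟩
      u                                                    ∎
      where
      open ≡-Reasoning
      1+a≈ : 1 + label u ≈ label (vertex (suc (label u)))
      1+a≈ = sym (trans (cong (_% v) (label-vertex _)) (%-≈ _))

  iterate-rotate : ∀ k z → iter rotate k (vertex z) ≡ vertex (z + k)
  iterate-rotate zero    z = cong vertex (sym (+-identityʳ z))
  iterate-rotate (suc k) z = begin
    rotate (iter rotate k (vertex z))   ≡⟨ cong rotate (iterate-rotate k z) ⟩
    rotate (vertex (z + k))             ≡⟨ rotate-vertex (z + k) ⟩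
    vertex (suc (z + k))                ≡⟨ cong vertex (+-suc z k) ⟨
    vertex (z + suc k)                  ∎
    where open ≡-Reasoning

  rotation-fullCycle : IsFullCycle rotation
  rotation-fullCycle u w = k , (begin
    iter rotate k u                     ≡⟨ cong (iter rotate k) (vertex-label u) ⟨
    iter rotate k (vertex (label u))    ≡⟨ iterate-rotate k (label u) ⟩
    vertex (label u + k)                ≡⟨ vertex-cong (+diffMod (label u) (label w)) ⟩
    vertex (label w)                    ≡⟨ vertex-label w ⟩
    w                                   ∎)
    where
    open ≡-Reasoning
    k : ℕ
    k = diffMod (label u) (label w)


record ShortDifferenceFamily (Γ : Graph) (M H n : ℕ) : Set where
  field
    orientation    : Orientation Γ
    base           : Fin n → Fin (nV Γ) → ℕ
    base<2H        : ∀ i x → base i x < H + H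
    base-injective : ∀ i → Injective _≡_ _≡_ (base i)
    Δ              : Fin n → Fin (size Γ) → ℕ
    base-high      : ∀ i j → base i (Orientation.high orientation j) ≡ base i (Orientation.low orientation j) + Δ i j
    Δ<H            : ∀ i j → Δ i j < H
    M∤Δ            : ∀ i j → ¬ M ∣ Δ i j
    Δ-onto         : ∀ δ → δ < H → ¬ M ∣ δ → ∃[ i ] ∃[ j ] Δ i j ≡ δ
    Δ-injective    : ∀ {i j i' j'} → Δ i j ≡ Δ i' j' → i ≡ i' × j ≡ j'

-- An edge {a, b} of K has a unique short difference ±(b − a) ∈ (0, H), which is
-- the difference of a unique edge j of a unique base block i; the translate
-- taking low j to a is then the unique block through {a, b}.
module Development {Γ : Graph} {M N H n : ℕ} .{{_ : NonZero M}} .{{_ : NonZero N}}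
  (v≡2H : N * M ≡ H + H) (M∣H : M ∣ H) (F : ShortDifferenceFamily Γ M H n) where

  open CyclicModel M N
  open ShortDifferenceFamily F
  open Orientation orientation

  Block : Set
  Block = Fin n × Fin v

  translate : Block → Fin (nV Γ) → KV M N
  translate (i , s) x = vertex (toℕ s + base i x)

  base<v : ∀ i x → base i x < v
  base<v i x = subst (base i x <_) (sym v≡2H) (base<2H i x)

  translate-injective : ∀ p → Injective _≡_ _≡_ (translate p)
  translate-injective (i , s) {x} {y} eq =
    base-injective i (≈⇒≡ (base<v i x) (base<v i y) (≈-cancelˡ (toℕ s) (vertex-injective eq)))

  translate-high : ∀ i j (s : Fin v) → toℕ s + base i (high j) ≡ toℕ s + base i (low j) + Δ i j
  translate-high i j s = trans (cong (toℕ s +_) (base-high i j)) (sym (+-assoc (toℕ s) _ _))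

  -- the two ends of an edge differ by Δ i j ≢ 0 mod M, so lie in different parts
  translate-separates : ∀ p j → KAdj (translate p (low j)) (translate p (high j))
  translate-separates (i , s) j = ≢⇒separated λ same-part →
    M∤Δ i j (Modulo.≈-shift⇒∣ M (toℕ s + base i (low j)) (trans same-part (cong (_% M) (translate-high i j s))))

  develop : Block → Copy Γ M N
  develop p = orientedCopy orientation (translate p) (translate-injective p) (translate-separates p)

  Arc : Block → Fin (size Γ) → ℕ → ℕ → Set
  Arc (i , s) j a b = toℕ s + base i (low j) ≈ a × toℕ s + base i (high j) ≈ b

  covers⇒arc : ∀ p a b → Covers (develop p) (vertex a) (vertex b) → ∃[ j ] (Arc p j a b ⊎ Arc p j b a)
  covers⇒arc p a b cov with Equivalence.to (covers⇔ orientation (develop p) _ _) cov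
  ... | j , inj₁ (e₁ , e₂) = j , inj₁ (vertex-injective e₁ , vertex-injective e₂)
  ... | j , inj₂ (e₁ , e₂) = j , inj₂ (vertex-injective e₁ , vertex-injective e₂)

  arc⇒covers : ∀ p j a b → Arc p j a b → Covers (develop p) (vertex a) (vertex b)
  arc⇒covers p j a b (e₁ , e₂) = Equivalence.from (covers⇔ orientation (develop p) _ _) (j , inj₁ (vertex-cong e₁ , vertex-cong e₂))

  arc-difference : ∀ i s j a b → Arc (i , s) j a b → a + Δ i j ≈ b
  arc-difference i s j a b (e₁ , e₂) = begin
    (a + Δ i j) % v                              ≡⟨ ≈-+ {a} (sym e₁) refl ⟩
    (toℕ s + base i (low j) + Δ i j) % v         ≡⟨ cong (_% v) (translate-high i j s) ⟨
    (toℕ s + base i (high j)) % v                ≡⟨ e₂ ⟩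
    b % v                                        ∎
    where open ≡-Reasoning

  arc-Δ : ∀ i s j a b → Arc (i , s) j a b → Δ i j ≡ diffMod a b
  arc-Δ i s j a b arc = diffMod-unique (arc-difference i s j a b arc) (<-≤-trans (Δ<H i j) H≤v)
    where
    H≤v : H ≤ v
    H≤v = subst (H ≤_) (sym v≡2H) (m≤m+n H H)

  arc-translation : ∀ i s s' j a b b' → Arc (i , s) j a b → Arc (i , s') j a b' → s ≡ s'
  arc-translation i s s' j a b b' (e , _) (e' , _) = toℕ-injective
    (≈⇒≡ (toℕ<n s) (toℕ<n s') (≈-cancelˡ (base i (low j)) (trans (cong (_% v) (+-comm _ (toℕ s)))
      (trans (trans e (sym e')) (cong (_% v) (+-comm (toℕ s') _))))))

  no-backward-arc : ∀ a b → diffMod a b < H → ∀ i s j → ¬ Arc (i , s) j b a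
  no-backward-arc a b δ<H i s j arc = M∤Δ i j (subst (M ∣_) (sym Δ≡0) (M ∣0))
    where
    open ≡-Reasoning
    δ : ℕ
    δ = diffMod a b
    sum≈0 : δ + Δ i j ≈ 0
    sum≈0 = ≈-cancelˡ a (begin
      (a + (δ + Δ i j)) % v     ≡⟨ cong (_% v) (+-assoc a δ (Δ i j)) ⟨
      (a + δ + Δ i j) % v       ≡⟨ ≈-+ (+diffMod a b) refl ⟩
      (b + Δ i j) % v           ≡⟨ arc-difference i s j b a arc ⟩
      a % v                     ≡⟨ cong (_% v) (+-identityʳ a) ⟨
      (a + 0) % v               ∎)
    sum<v : δ + Δ i j < v
    sum<v = subst (δ + Δ i j <_) (sym v≡2H) (+-mono-< δ<H (Δ<H i j))
    Δ≡0 : Δ i j ≡ 0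
    Δ≡0 = m+n≡0⇒n≡0 δ (≈⇒≡ sum<v (>-nonZero⁻¹ v) sum≈0)

  UniqueCover : KV M N → KV M N → Set
  UniqueCover u w = Σ Block λ p → Covers (develop p) u w × (∀ p' → Covers (develop p') u w → p' ≡ p)

  UniqueCover-sym : ∀ {u w} → UniqueCover u w → UniqueCover w u
  UniqueCover-sym (p , cov , unique) = p , Covers-sym (develop p) cov , λ p' cov' → unique p' (Covers-sym (develop p') cov')

  short-cover : ∀ a b → diffMod a b < H → ¬ M ∣ diffMod a b → UniqueCover (vertex a) (vertex b)
  short-cover a b δ<H M∤δ = (i , s) , arc⇒covers (i , s) j a b arc , unique
    where
    open ≡-Reasoning
    δ : ℕ
    δ = diffMod a b
    i : Fin n
    i = proj₁ (Δ-onto δ δ<H M∤δ)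
    j : Fin (size Γ)
    j = proj₁ (proj₂ (Δ-onto δ δ<H M∤δ))
    Δij≡δ : Δ i j ≡ δ
    Δij≡δ = proj₂ (proj₂ (Δ-onto δ δ<H M∤δ))
    -- translate so that low j lands on a
    s : Fin v
    s = fromℕ< (diffMod<q (base i (low j)) a)
    low↦a : toℕ s + base i (low j) ≈ a
    low↦a = begin
      (toℕ s + base i (low j)) % v                    ≡⟨ cong (λ x → (x + base i (low j)) % v) (toℕ-fromℕ< _) ⟩
      (diffMod (base i (low j)) a + base i (low j)) % v ≡⟨ cong (_% v) (+-comm _ (base i (low j))) ⟩
      (base i (low j) + diffMod (base i (low j)) a) % v ≡⟨ +diffMod (base i (low j)) a ⟩
      a % v                                           ∎
    arc : Arc (i , s) j a b
    arc = low↦a , (begin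
      (toℕ s + base i (high j)) % v                   ≡⟨ cong (_% v) (translate-high i j s) ⟩
      (toℕ s + base i (low j) + Δ i j) % v            ≡⟨ ≈-+ low↦a (cong (_% v) Δij≡δ) ⟩
      (a + δ) % v                                     ≡⟨ +diffMod a b ⟩
      b % v                                           ∎)
    unique : ∀ p' → Covers (develop p') (vertex a) (vertex b) → p' ≡ (i , s)
    unique (i' , s') cov with covers⇒arc (i' , s') a b cov
    ... | j' , inj₂ arc' = ⊥-elim (no-backward-arc a b δ<H i' s' j' arc')
    ... | j' , inj₁ arc'
      with Δ-injective (trans (arc-Δ i' s' j' a b arc') (sym (arc-Δ i s j a b arc)))
    ...   | refl , refl = cong (i ,_) (arc-translation i s' s j a b b arc' arc)

  M∤diffMod : ∀ {a b} → a % M ≢ b % M → ¬ M ∣ diffMod a b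
  M∤diffMod {a} {b} a≢b M∣δ = a≢b (begin
    a % M                      ≡⟨ %-remove-+ʳ a M∣δ ⟨
    (a + diffMod a b) % M      ≡⟨ m∣n⇒o%n%m≡o%m M v _ (n∣m*n N) ⟨
    (a + diffMod a b) % v % M  ≡⟨ cong (_% M) (+diffMod a b) ⟩
    b % v % M                  ≡⟨ m∣n⇒o%n%m≡o%m M v b (n∣m*n N) ⟩
    b % M                      ∎)
    where open ≡-Reasoning

  -- every pair of labels in different parts is covered by exactly one block:
  -- one of the two cyclic differences between them is short
  cover-labels : ∀ a b → a % M ≢ b % M → UniqueCover (vertex a) (vertex b)
  cover-labels a b a≢b with diffMod a b <? H
  ... | yes δ<H = short-cover a b δ<H (M∤diffMod a≢b)
  ... | no  δ≮H = UniqueCover-sym (short-cover b a reverse-short (M∤diffMod (a≢b ∘ sym)))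
    where
    δ : ℕ
    δ = diffMod a b
    0<δ : 0 < δ
    0<δ = n≢0⇒n>0 λ δ≡0 → M∤diffMod a≢b (subst (M ∣_) (sym δ≡0) (M ∣0))
    H<δ : H < δ
    H<δ = ≤∧≢⇒< (≮⇒≥ δ≮H) λ H≡δ → M∤diffMod a≢b (subst (M ∣_) H≡δ M∣H)
    reverse-short : diffMod b a < H
    reverse-short = begin-strict
      diffMod b a   ≡⟨ diffMod-flip a b 0<δ ⟩
      v ∸ δ         <⟨ ∸-monoʳ-< H<δ (<⇒≤ (diffMod<q a b)) ⟩
      v ∸ H         ≡⟨ cong (_∸ H) v≡2H ⟩
      H + H ∸ H     ≡⟨ m+n∸n≡m H H ⟩
      H             ∎
      where open ≤-Reasoning

  unique-cover : ∀ u w → KAdj u w → UniqueCover u w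
  unique-cover u w sep = subst₂ UniqueCover (vertex-label u) (vertex-label w)
    (cover-labels (label u) (label w) (separated⇒≢ (subst₂ KAdj (sym (vertex-label u)) (sym (vertex-label w)) sep)))

  decomposition : Decomposition Γ M N
  decomposition = record { t = n * v ; block = develop ∘ remQuot v ; partition = indexed-cover }
    where
    indexed-cover : ∀ u w → KAdj u w → Σ (Fin (n * v)) λ k →
      Covers (develop (remQuot v k)) u w × (∀ k' → Covers (develop (remQuot v k')) u w → k' ≡ k)
    indexed-cover u w sep with unique-cover u w sep
    ... | (i , s) , cov , unique =
      combine i s ,
      subst (λ p → Covers (develop p) u w) (sym (remQuot-combine i s)) cov ,
      λ k' cov' → trans (sym (combine-remQuot {n} v k')) (cong (uncurry combine) (unique (remQuot v k') cov'))

  rotate-translate : ∀ i (s s' : Fin v) → suc (toℕ s) ≈ toℕ s' →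
                     MapsOnto rotation (develop (i , s)) (develop (i , s'))
  rotate-translate i s s' s+1≈s' = image-mapsOnto rotation (develop (i , s)) (develop (i , s')) λ x → begin
    vertex (toℕ s' + base i x)          ≡⟨ vertex-cong (≈-+ (sym s+1≈s') refl) ⟩
    vertex (suc (toℕ s + base i x))     ≡⟨ rotate-vertex (toℕ s + base i x) ⟨
    rotate (vertex (toℕ s + base i x))  ∎
    where open ≡-Reasoning

  -- the translates of each base block form one orbit of the rotation
  cyclic : IsCyclic decomposition
  cyclic = rotation , rotation-fullCycle , forward , backward
    where
    develop-combine : ∀ i s → develop (remQuot v (combine i s)) ≡ develop (i , s)
    develop-combine i s = cong develop (remQuot-combine i s)
    forward : ∀ k → ∃[ k' ] MapsOnto rotation (develop (remQuot v k)) (develop (remQuot v k'))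
    forward k = combine i s⁺ , subst (MapsOnto rotation (develop (i , s))) (sym (develop-combine i s⁺))
                                     (rotate-translate i s s⁺ (sym (trans (cong (_% v) (toℕ-fromℕ< _)) (%-≈ _))))
      where
      i : Fin n
      i = proj₁ (remQuot {n} v k)
      s s⁺ : Fin v
      s = proj₂ (remQuot {n} v k)
      s⁺ = fromℕ< (m%n<n (suc (toℕ s)) v)
    backward : ∀ k' → ∃[ k ] MapsOnto rotation (develop (remQuot v k)) (develop (remQuot v k'))
    backward k' = combine i s⁻ , subst (λ B → MapsOnto rotation B (develop (i , s'))) (sym (develop-combine i s⁻))
                                       (rotate-translate i s⁻ s' (trans (cong (λ x → suc x % v) (toℕ-fromℕ< _)) (+diffMod 1 (toℕ s'))))
      where
      i : Fin n
      i = proj₁ (remQuot {n} v k')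
      s' s⁻ : Fin v
      s' = proj₂ (remQuot {n} v k')
      s⁻ = fromℕ< (diffMod<q 1 (toℕ s'))

InTarget⇔ : ∀ d m k → InTarget d m k ⇔ (k < d * suc m × ¬ suc m ∣ k)
InTarget⇔ d m k = mk⇔ to from
  where
  to : InTarget d m k → k < d * suc m × ¬ suc m ∣ k
  to ((1≤k , k<D) , no-multiple) = k<D , λ { (divides j k≡jM) →
    no-multiple (j , 1≤j j k≡jM , *-cancelʳ-< (suc m) j d (subst (_< d * suc m) k≡jM k<D) , k≡jM) }
    where
    1≤j : ∀ j → k ≡ j * suc m → 1 ≤ j
    1≤j zero    k≡0 = contradiction (subst (1 ≤_) k≡0 1≤k) λ ()
    1≤j (suc j) _   = s≤s z≤n
  from : k < d * suc m × ¬ suc m ∣ k → InTarget d m k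
  from (k<D , M∤k) = (n≢0⇒n>0 (λ k≡0 → M∤k (subst (suc m ∣_) (sym k≡0) (suc m ∣0))) , k<D) ,
                     λ { (j , _ , _ , k≡jM) → M∤k (divides j k≡jM) }

-- The d·m target numbers are enumerated by code k = (k mod (m+1) − 1) + m·⌊k/(m+1)⌋.
module TargetNumbering (d m : ℕ) where

  code : ℕ → ℕ
  code k = (k % suc m ∸ 1) + (k / suc m) * m

  code< : ∀ {k} → k < d * suc m → ¬ suc m ∣ k → code k < d * m
  code< {k} k<D M∤k with k % suc m in r≡ | m%n<n k (suc m)
  ... | zero  | _         = contradiction (m%n≡0⇒n∣m k (suc m) r≡) M∤k
  ... | suc r | s≤s r<m   = digits-< {Q = d} r<m (m<n*o⇒m/o<n k<D)

  code-onto : ∀ t → t < d * m → ∃[ k ] ((k < d * suc m × ¬ suc m ∣ k) × code k ≡ t)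
  code-onto t t<dm = k , (k<D , M∤k) , code-k
    where
    instance
      m-nonZero : NonZero m
      m-nonZero = ≢-nonZero λ m≡0 → n≮0 (subst (t <_) (trans (cong (d *_) m≡0) (*-zeroʳ d)) t<dm)
    k : ℕ
    k = suc (t % m) + (t / m) * suc m
    k-digits : k % suc m ≡ suc (t % m) × k / suc m ≡ t / m
    k-digits = digits (t / m) (s≤s (m%n<n t m))
    k<D : k < d * suc m
    k<D = digits-< {Q = d} (s≤s (m%n<n t m)) (m<n*o⇒m/o<n t<dm)
    M∤k : ¬ suc m ∣ k
    M∤k M∣k = 1+n≢0 (trans (sym (proj₁ k-digits)) (n∣m⇒m%n≡0 k (suc m) M∣k))
    code-k : code k ≡ t
    code-k = begin
      (k % suc m ∸ 1) + (k / suc m) * m    ≡⟨ cong₂ (λ r q → (r ∸ 1) + q * m) (proj₁ k-digits) (proj₂ k-digits) ⟩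
      t % m + (t / m) * m                  ≡⟨ m≡m%n+[m/n]*n t m ⟨
      t                                    ∎
      where open ≡-Reasoning

-- A d-graceful α-labeling f of Γ (size d·m, colouring c, f(X) < f(Y)) yields,
-- for every n, a short difference family with M = m + 1 and H = n·d·(m+1):
-- orient each edge from X to Y; base block i keeps f on X and shifts f on Y
-- by i·d(m+1).  The edge differences of block i are the graceful differences
-- shifted by i·d(m+1), so together they enumerate the non-multiples of m + 1
-- below n·d(m+1).
module AlphaFamily {Γ : Graph} {d m : ℕ} .{{_ : NonZero d}} (size≡dm : size Γ ≡ d * m)
  {f : Fin (nV Γ) → ℕ} (α : IsDGracefulAlpha Γ d m f) (n : ℕ) where

  M D H : ℕ
  M = suc m
  D = d * M
  H = n * D

  instance
    D-nonZero : NonZero D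
    D-nonZero = m*n≢0 d M

  f-injective : Injective _≡_ _≡_ f
  f-injective = proj₁ (proj₁ α)

  f<D : ∀ x → f x < D
  f<D = proj₁ (proj₂ (proj₁ α))

  differences : ∀ k → InDiffSet Γ f k ⇔ InTarget d m k
  differences = proj₂ (proj₂ (proj₁ α))

  c : Fin (nV Γ) → Bool
  c = proj₁ (proj₂ α)

  X<Y : ∀ x y → c x ≡ false → c y ≡ true → f x < f y
  X<Y = proj₂ (proj₂ (proj₂ α))

  record Ends (e : Fin (nV Γ) × Fin (nV Γ)) : Set where
    field
      x y   : Fin (nV Γ)
      x∈X   : c x ≡ false
      y∈Y   : c y ≡ true
      order : SameEdge e (x , y)

  ends : ∀ {e} → c (proj₁ e) ≢ c (proj₂ e) → Ends e
  ends {a , b} proper with c a in ca | c b in cb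
  ... | false | true  = record { x = a ; y = b ; x∈X = ca ; y∈Y = cb ; order = inj₁ (refl , refl) }
  ... | true  | false = record { x = b ; y = a ; x∈X = cb ; y∈Y = ca ; order = inj₂ (refl , refl) }
  ... | false | false = contradiction refl proper
  ... | true  | true  = contradiction refl proper

  edge-ends : ∀ j → Ends (lookup (E Γ) j)
  edge-ends j = ends (All.lookup (proj₁ (proj₂ (proj₂ α))) (∈-lookup j))

  orientation : Orientation Γ
  orientation = record
    { low = Ends.x ∘ edge-ends ; high = Ends.y ∘ edge-ends ; oriented = Ends.order ∘ edge-ends }

  open Orientation orientation

  gap : Fin (size Γ) → ℕ
  gap j = f (high j) ∸ f (low j)

  low<high : ∀ j → f (low j) < f (high j)
  low<high j = X<Y _ _ (Ends.x∈X (edge-ends j)) (Ends.y∈Y (edge-ends j))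

  f-high : ∀ j → f (high j) ≡ f (low j) + gap j
  f-high j = sym (m+[n∸m]≡n (<⇒≤ (low<high j)))

  gap-edge : ∀ j → ∣ f (proj₁ (lookup (E Γ) j)) - f (proj₂ (lookup (E Γ) j)) ∣ ≡ gap j
  gap-edge j with Ends.order (edge-ends j)
  ... | inj₁ (e₁ , e₂) = trans (cong₂ (λ a b → ∣ f a - f b ∣) e₁ e₂) (m≤n⇒∣m-n∣≡n∸m (<⇒≤ (low<high j)))
  ... | inj₂ (e₁ , e₂) = trans (cong₂ (λ a b → ∣ f a - f b ∣) e₁ e₂) (m≤n⇒∣n-m∣≡n∸m (<⇒≤ (low<high j)))

  gap-target : ∀ j → gap j < D × ¬ M ∣ gap j
  gap-target j = Equivalence.to (InTarget⇔ d m (gap j))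
    (Equivalence.to (differences (gap j)) (lose (∈-lookup j) (gap-edge j)))

  gap-onto : ∀ k → k < D → ¬ M ∣ k → ∃[ j ] gap j ≡ k
  gap-onto k k<D M∤k = Any.index hit , trans (sym (gap-edge (Any.index hit))) (lookup-index hit)
    where
    hit : InDiffSet Γ f k
    hit = Equivalence.from (differences k) (Equivalence.from (InTarget⇔ d m k) (k<D , M∤k))

  -- there are as many edges as target numbers, so the gaps are distinct
  gap-injective : Injective _≡_ _≡_ gap
  gap-injective = onto-code⇒injective gap code
    (λ j → subst (code (gap j) <_) (sym size≡dm) (code< (proj₁ (gap-target j)) (proj₂ (gap-target j))))
    λ t t<L → let (k , (k<D , M∤k) , code-k) = code-onto t (subst (t <_) size≡dm t<L)
                  (j , gap-j) = gap-onto k k<D M∤k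
              in j , trans (cong code gap-j) code-k
    where open TargetNumbering d m

  shift : Fin n → Bool → ℕ
  shift i false = 0
  shift i true  = toℕ i * D

  base : Fin n → Fin (nV Γ) → ℕ
  base i x = f x + shift i (c x)

  Δ : Fin n → Fin (size Γ) → ℕ
  Δ i j = gap j + toℕ i * D

  M∣iD : ∀ (i : Fin n) → M ∣ toℕ i * D
  M∣iD i = ∣n⇒∣m*n (toℕ i) (n∣m*n d)

  base<H : ∀ i x → base i x < H
  base<H i x = begin-strict
    f x + shift i (c x)   ≤⟨ +-monoʳ-≤ (f x) (shift≤ (c x)) ⟩
    f x + toℕ i * D       <⟨ digits-< (f<D x) (toℕ<n i) ⟩
    n * D                 ∎
    where
    open ≤-Reasoning
    shift≤ : ∀ b → shift i b ≤ toℕ i * D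
    shift≤ false = z≤n
    shift≤ true  = ≤-refl

  X-below-Y : ∀ (i : Fin n) {x y} → c x ≡ false → c y ≡ true → f x + 0 < f y + toℕ i * D
  X-below-Y i {x} {y} x∈X y∈Y = begin-strict
    f x + 0              ≡⟨ +-identityʳ (f x) ⟩
    f x                  <⟨ X<Y x y x∈X y∈Y ⟩
    f y                  ≤⟨ m≤m+n (f y) _ ⟩
    f y + toℕ i * D      ∎
    where open ≤-Reasoning

  colours-separate : ∀ i {x y} → c x ≢ c y → base i x ≢ base i y
  colours-separate i {x} {y} c≢ with c x in cx | c y in cy
  ... | false | true  = <⇒≢ (X-below-Y i cx cy)
  ... | true  | false = ≢-sym (<⇒≢ (X-below-Y i cy cx))
  ... | false | false = contradiction refl c≢
  ... | true  | true  = contradiction refl c≢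

  base-injective : ∀ i → Injective _≡_ _≡_ (base i)
  base-injective i {x} {y} eq with c x ≟ᵇ c y
  ... | yes same  = f-injective (+-cancelʳ-≡ _ (f x) (f y) (trans eq (cong (λ b → f y + shift i b) (sym same))))
  ... | no differ = contradiction eq (colours-separate i differ)

  base-high : ∀ i j → base i (high j) ≡ base i (low j) + Δ i j
  base-high i j = begin
    f (high j) + shift i (c (high j))   ≡⟨ cong (λ b → f (high j) + shift i b) (Ends.y∈Y (edge-ends j)) ⟩
    f (high j) + toℕ i * D              ≡⟨ cong (_+ toℕ i * D) (f-high j) ⟩
    f (low j) + gap j + toℕ i * D       ≡⟨ +-assoc (f (low j)) (gap j) _ ⟩
    f (low j) + Δ i j                   ≡⟨ cong (_+ Δ i j) (+-identityʳ (f (low j))) ⟨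
    f (low j) + 0 + Δ i j               ≡⟨ cong (λ b → f (low j) + shift i b + Δ i j) (Ends.x∈X (edge-ends j)) ⟨
    f (low j) + shift i (c (low j)) + Δ i j ∎
    where open ≡-Reasoning

  M∤Δ : ∀ i j → ¬ M ∣ Δ i j
  M∤Δ i j M∣Δ = proj₂ (gap-target j) (∣m+n∣m⇒∣n (subst (M ∣_) (+-comm (gap j) _) M∣Δ) (M∣iD i))

  -- δ < n·D splits as δ mod D (a gap) plus ⌊δ/D⌋·D (a block shift)
  Δ-onto : ∀ δ → δ < H → ¬ M ∣ δ → ∃[ i ] ∃[ j ] Δ i j ≡ δ
  Δ-onto δ δ<H M∤δ = i , j , trans (cong (_+ toℕ i * D) gap-j) (sym δ≡r+iD)
    where
    i<n : δ / D < n
    i<n = m<n*o⇒m/o<n {n = n} {o = D} δ<H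
    i : Fin n
    i = fromℕ< i<n
    δ≡r+iD : δ ≡ δ % D + toℕ i * D
    δ≡r+iD = trans (m≡m%n+[m/n]*n δ D) (cong (λ q → δ % D + q * D) (sym (toℕ-fromℕ< i<n)))
    M∤r : ¬ M ∣ δ % D
    M∤r M∣r = M∤δ (subst (M ∣_) (sym δ≡r+iD) (∣m∣n⇒∣m+n M∣r (M∣iD i)))
    j : Fin (size Γ)
    j = proj₁ (gap-onto (δ % D) (m%n<n δ D) M∤r)
    gap-j : gap j ≡ δ % D
    gap-j = proj₂ (gap-onto (δ % D) (m%n<n δ D) M∤r)

  Δ-injective : ∀ {i j i' j'} → Δ i j ≡ Δ i' j' → i ≡ i' × j ≡ j'
  Δ-injective {i} {j} {i'} {j'} eq =
    let (gap≡ , i≡) = digits-injective (proj₁ (gap-target j)) (proj₁ (gap-target j')) eq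
    in toℕ-injective i≡ , gap-injective gap≡

  family : ShortDifferenceFamily Γ M H n
  family = record
    { orientation = orientation
    ; base = base
    ; base<2H = λ i x → <-≤-trans (base<H i x) (m≤m+n H H)
    ; base-injective = base-injective
    ; Δ = Δ
    ; base-high = base-high
    ; Δ<H = λ i j → digits-< (proj₁ (gap-target j)) (toℕ<n i)
    ; M∤Δ = M∤Δ
    ; Δ-onto = Δ-onto
    ; Δ-injective = Δ-injective
    }

vertex-count : ∀ d n M → 2 * d * n * M ≡ n * (d * M) + n * (d * M)
vertex-count = solve-∀

-- Theorem 2.6: the development of the short difference family obtained from a
-- d-graceful α-labeling is a cyclic Γ-decomposition of K_{(m+1)×2dn}.
theorem2p6 : (Γ : Graph) (d m : ℕ) → 1 ≤ d → size Γ ≡ d * m →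
    IsBipartite Γ → HasDGracefulAlpha Γ d m →
    ∀ (n : ℕ) → 1 ≤ n →
    ∃[ D ] IsCyclic {Γ} {suc m} {2 * d * n} D
theorem2p6 Γ d m 1≤d size≡dm _ (f , α) n 1≤n = decomposition , cyclic
  where
  instance
    d-nonZero : NonZero d
    d-nonZero = >-nonZero 1≤d
    n-nonZero : NonZero n
    n-nonZero = >-nonZero 1≤n
    N-nonZero : NonZero (2 * d * n)
    N-nonZero = m*n≢0 (2 * d) n {{m*n≢0 2 d}}
  M∣H : suc m ∣ n * (d * suc m)
  M∣H = ∣n⇒∣m*n n (n∣m*n d)
  open Development (vertex-count d n (suc m)) M∣H (AlphaFamily.family size≡dm α n)
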